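{- Let $D$ and $H$ be digraphs, and for each $u\in V(D)$ and $i\in V(H)$ let a positive cost $c_i(u)$ be given. Let $\mu=\max\{c_j(v):\ v\in V(D),\ j\in V(H)\}$, and let $D\otimes H$ be the homomorphic product of $D$ and $H$, with vertex weights $c(u_i)=c_i(u)+\mu|V(D)|$. Then there is a homomorphism of $D$ to $H$ if and only if the number of vertices in a largest independent set of $D\otimes H$ equals $|V(D)|$. Moreover, if $HOM(D,H)\neq\emptyset$, then a homomorphism $h\in HOM(D,H)$ is of maximum cost if and only if $I=\{x_{h(x)}:\ x\in V(D)\}$ is an independent set of $D\otimes H$ of maximum cost, where the cost of a set $X\subseteq V(D\otimes H)$ is $c(X)=\sum_{x\in X}c(x)$.
   Context: Digraphs have no loops and no parallel arcs (pairs of opposite arcs are allowed). For digraphs $D,H$, a map $f:V(D)\to V(H)$ is a homomorphism of $D$ to $H$ if $uv\in A(D)$ implies $f(u)f(v)\in A(H)$; $HOM(D,H)$ denotes the set of all homomorphisms of $D$ to $H$. The cost of a homomorphism $f$ is $\sum_{u\in V(D)}c_{f(u)}(u)$. The homomorphic product $D\otimes H$ is the undirected graph with vertex set $\{u_i:\ u\in V(D),\ i\in V(H)\}$ and edge set $\{u_iv_j:\ uv\in A(D),\ ij\notin A(H)\}\cup\{u_iu_j:\ u\in V(D),\ i\neq j\in V(H)\}$.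
   Formalization: The costs $c_i(u)$ take positive rational values. -}

module Defs where

open import Data.Nat using (ℕ; zero; suc)
open import Data.Fin using (Fin; zero; suc)
open import Data.Fin.Properties using (_≟_)
open import Data.Bool using (Bool; true; false; if_then_else_; _∧_; not)
open import Data.Product using (Σ; _×_; _,_; ∃)
open import Data.Integer using (+_)
open import Data.Rational using (ℚ; 0ℚ; _+_; _*_; _⊔_; _≤_; _/_; Positive)
open import Relation.Nullary using (¬_)
open import Relation.Nullary.Decidable using (⌊_⌋)
open import Relation.Binary.PropositionalEquality using (_≡_; _≢_)

-- A digraph on vertex set Fin n: a Bool-valued arc relation without loops.
-- (A relation cannot express parallel arcs; opposite arcs are allowed.)
record Digraph : Set where
  field
    size     : ℕ
    arc      : Fin size → Fin size → Bool
    loopless : ∀ u → arc u u ≡ false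
open Digraph public

V : Digraph → Set
V D = Fin (size D)

Arc : (D : Digraph) → V D → V D → Set
Arc D u v = arc D u v ≡ true

IsHom : (D H : Digraph) → (V D → V H) → Set
IsHom D H f = ∀ u v → Arc D u v → Arc H (f u) (f v)

HOM-nonempty : Digraph → Digraph → Set
HOM-nonempty D H = Σ (V D → V H) (IsHom D H)

sumℚ : ∀ {k} → (Fin k → ℚ) → ℚ
sumℚ {zero} f = 0ℚ
sumℚ {suc k} f = f zero + sumℚ (λ i → f (suc i))

sumℕ : ∀ {k} → (Fin k → ℕ) → ℕ
sumℕ {zero} f = 0
sumℕ {suc k} f = f zero Data.Nat.+ sumℕ (λ i → f (suc i))

-- finite maximum over Fin k (0 on the empty domain)
maxℚ : ∀ {k} → (Fin k → ℚ) → ℚ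
maxℚ {zero} f = 0ℚ
maxℚ {suc k} f = f zero ⊔ maxℚ (λ i → f (suc i))

-- cost functions: c u i = c_i(u)
Cost : Digraph → Digraph → Set
Cost D H = V D → V H → ℚ

homCost : (D H : Digraph) → Cost D H → (V D → V H) → ℚ
homCost D H c f = sumℚ (λ u → c u (f u))

IsMaxCostHom : (D H : Digraph) → Cost D H → (V D → V H) → Set
IsMaxCostHom D H c h =
  IsHom D H h × (∀ g → IsHom D H g → homCost D H c g ≤ homCost D H c h)

-- The homomorphic product D ⊗ H: vertex u_i is the pair (u , i).
-- Adjacency of u_i and v_j (as an undirected graph):
Adj⊗ : (D H : Digraph) → V D → V H → V D → V H → Set
Adj⊗ D H u i v j =
  (Arc D u v × ¬ Arc H i j) ⊎' (Arc D v u × ¬ Arc H j i) ⊎' (u ≡ v × i ≢ j)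
  where
  open import Data.Sum using () renaming (_⊎_ to _⊎'_)

VSet : Digraph → Digraph → Set
VSet D H = V D → V H → Bool

Independent : (D H : Digraph) → VSet D H → Set
Independent D H X =
  ∀ u i v j → X u i ≡ true → X v j ≡ true → ¬ Adj⊗ D H u i v j

card : (D H : Digraph) → VSet D H → ℕ
card D H X = sumℕ (λ u → sumℕ (λ i → if X u i then 1 else 0))

IndependenceNumber : (D H : Digraph) → ℕ → Set
IndependenceNumber D H k =
  (Σ (VSet D H) λ X → Independent D H X × card D H X ≡ k)
  × (∀ X → Independent D H X → card D H X Data.Nat.≤ k)

μ : (D H : Digraph) → Cost D H → ℚ
μ D H c = maxℚ (λ v → maxℚ (λ j → c v j))

weight : (D H : Digraph) → Cost D H → V D → V H → ℚ
weight D H c u i = c u i + μ D H c * ((+ size D) / 1)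

setCost : (D H : Digraph) → Cost D H → VSet D H → ℚ
setCost D H c X = sumℚ (λ u → sumℚ (λ i → if X u i then weight D H c u i else 0ℚ))

IsMaxCostIndep : (D H : Digraph) → Cost D H → VSet D H → Set
IsMaxCostIndep D H c X =
  Independent D H X × (∀ Y → Independent D H Y → setCost D H c Y ≤ setCost D H c X)

imageSet : (D H : Digraph) → (V D → V H) → VSet D H
imageSet D H h x i = ⌊ h x ≟ i ⌋

{-# OPTIONS --safe #-}
-- In D ⊗ H the copies u_i (i ∈ V(H)) of a vertex u form a clique, so an
-- independent set meets each row {u_i : i ∈ V(H)} in at most one vertex. It
-- meets all n = |V(D)| rows exactly when it is {x_{g(x)}} for a map g, and then
-- independence says precisely that g is a homomorphism. Such a set costs
-- c(g) + μn² ≥ μn², whereas an independent set missing a row costs at most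
-- (n − 1)(μ + μn) ≤ μn²; so the maximum-cost independent sets are the images of
-- maximum-cost homomorphisms.
module Submission where

open import Defs
open import Algebra.Bundles using (CommutativeMonoid)
open import Data.Bool using (Bool; true; false; if_then_else_)
import Data.Bool.Properties as Bool
open import Data.Fin using (Fin; zero; suc)
open import Data.Fin.Properties using (_≟_; suc-injective; any?; all?; ¬∀⟶∃¬)
import Data.Integer as ℤ
import Data.Integer.Properties as ℤ
open import Data.Nat as ℕ using (ℕ; zero; suc; z≤n; s≤s)
import Data.Nat.Properties as ℕ
import Data.Nat.Coprimality as Coprimality
open import Data.Product using (_×_; ∃; _,_; proj₁; proj₂; map₂)
open import Data.Rational using (ℚ; Positive; 0ℚ; 1ℚ; mkℚ; _+_; _*_; _/_; _≤_)
open import Data.Rational.Properties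
  using (≤-refl; ≤-trans; <⇒≤; <-irrefl; <-≤-trans; ≮⇒≥; positive⁻¹;
         +-mono-≤; +-monoˡ-≤; +-monoʳ-≤; +-monoˡ-<; +-comm; +-assoc; +-identityˡ; +-identityʳ;
         *-identityʳ; *-zeroʳ; *-distribˡ-+; p≤p⊔q; p≤q⊔p; normalize-coprime;
         +-0-commutativeMonoid; module ≤-Reasoning)
open import Algebra.Properties.CommutativeSemigroup
  (CommutativeMonoid.commutativeSemigroup +-0-commutativeMonoid) using (interchange)
open import Data.Sum using (_⊎_; inj₁; inj₂)
open import Function using (_∘_)
open import Function.Bundles using (_⇔_; mk⇔)
open import Relation.Nullary using (¬_; Dec; yes; no; contradiction)
open import Relation.Nullary.Decidable using (⌊_⌋; isYes≗does; dec-true; dec-false; decidable-stable)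
open import Relation.Binary.PropositionalEquality
  using (_≡_; _≢_; refl; sym; trans; cong; cong₂; subst; _≗_; module ≡-Reasoning)

select-cong : ∀ {a} {A : Set a} {k} {f f′ : Fin k → Bool} (g : Fin k → A) (z : A) →
  f ≗ f′ → (λ i → if f i then g i else z) ≗ (λ i → if f′ i then g i else z)
select-cong g z f≗f′ i = cong (λ b → if b then g i else z) (f≗f′ i)

TrueExactlyAt : ∀ {k} → (Fin k → Bool) → Fin k → Set
TrueExactlyAt f a = f a ≡ true × (∀ i → i ≢ a → f i ≡ false)

TrueExactlyAt-suc : ∀ {k} {f : Fin (suc k) → Bool} {a} →
  TrueExactlyAt f (suc a) → TrueExactlyAt (f ∘ suc) a
TrueExactlyAt-suc (fa , off) = fa , λ i i≢a → off (suc i) (i≢a ∘ suc-injective)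

TrueExactlyAt-unique : ∀ {k} {f : Fin k → Bool} {a i} → TrueExactlyAt f a → f i ≡ true → i ≡ a
TrueExactlyAt-unique {a = a} {i} (_ , off) fi = decidable-stable (i ≟ a)
  λ i≢a → contradiction (trans (sym fi) (off i i≢a)) λ ()

⌊≟⌋-TrueExactlyAt : ∀ {k} (a : Fin k) → TrueExactlyAt (λ i → ⌊ a ≟ i ⌋) a
⌊≟⌋-TrueExactlyAt a =
  trans (isYes≗does (a ≟ a)) (dec-true (a ≟ a) refl) ,
  λ i i≢a → trans (isYes≗does (a ≟ i)) (dec-false (a ≟ i) (i≢a ∘ sym))

occupied? : ∀ {k} (f : Fin k → Bool) → Dec (∃ λ i → f i ≡ true)
occupied? f = any? λ i → f i Bool.≟ true

unoccupied : ∀ {k} {f : Fin k → Bool} → ¬ (∃ λ i → f i ≡ true) → ∀ i → f i ≡ false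
unoccupied ∄i i = Bool.¬-not (∄i ∘ (i ,_))

sumℕ-cong : ∀ {k} {f g : Fin k → ℕ} → f ≗ g → sumℕ f ≡ sumℕ g
sumℕ-cong {zero}  f≗g = refl
sumℕ-cong {suc k} f≗g = cong₂ ℕ._+_ (f≗g zero) (sumℕ-cong (f≗g ∘ suc))

sumℕ-zero : ∀ k → sumℕ {k} (λ _ → 0) ≡ 0
sumℕ-zero zero    = refl
sumℕ-zero (suc k) = sumℕ-zero k

sumℕ-ones : ∀ k → sumℕ {k} (λ _ → 1) ≡ k
sumℕ-ones zero    = refl
sumℕ-ones (suc k) = cong suc (sumℕ-ones k)

sumℕ-select-none : ∀ {k} {f : Fin k → Bool} (g : Fin k → ℕ) → (∀ i → f i ≡ false) →
  sumℕ (λ i → if f i then g i else 0) ≡ 0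
sumℕ-select-none {k} g none = trans (sumℕ-cong (select-cong g 0 none)) (sumℕ-zero k)

sumℕ-select-single : ∀ {k} {f : Fin k → Bool} {a} (g : Fin k → ℕ) → TrueExactlyAt f a →
  sumℕ (λ i → if f i then g i else 0) ≡ g a
sumℕ-select-single {suc k} {f} {zero} g (f0 , off) rewrite f0 =
  trans (cong (g zero ℕ.+_) (sumℕ-select-none (g ∘ suc) λ i → off (suc i) λ ()))
        (ℕ.+-identityʳ (g zero))
sumℕ-select-single {suc k} {f} {suc a} g single rewrite proj₂ single zero λ () =
  sumℕ-select-single (g ∘ suc) (TrueExactlyAt-suc single)

sumℕ-≤ : ∀ {k} {f : Fin k → ℕ} → (∀ i → f i ℕ.≤ 1) → sumℕ f ℕ.≤ k
sumℕ-≤ {zero}  f≤1 = z≤n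
sumℕ-≤ {suc k} f≤1 = ℕ.+-mono-≤ (f≤1 zero) (sumℕ-≤ (f≤1 ∘ suc))

sumℕ-<-with-vanishing-term : ∀ {k} {f : Fin k → ℕ} (j : Fin k) →
  (∀ i → f i ℕ.≤ 1) → f j ≡ 0 → sumℕ f ℕ.< k
sumℕ-<-with-vanishing-term {suc k} {f} zero f≤1 fj≡0 rewrite fj≡0 = s≤s (sumℕ-≤ (f≤1 ∘ suc))
sumℕ-<-with-vanishing-term {suc k} {f} (suc j) f≤1 fj≡0 =
  subst (ℕ._≤ suc k) (ℕ.+-suc (f zero) _)
    (ℕ.+-mono-≤ (f≤1 zero) (sumℕ-<-with-vanishing-term j (f≤1 ∘ suc) fj≡0))

p≤q+p : ∀ {p q} → 0ℚ ≤ q → p ≤ q + p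
p≤q+p {p} {q} 0≤q = subst (_≤ q + p) (+-identityˡ p) (+-monoˡ-≤ p 0≤q)

+-cancelʳ-≤ : ∀ r {p q} → p + r ≤ q + r → p ≤ q
+-cancelʳ-≤ r p+r≤q+r = ≮⇒≥ λ q<p → <-irrefl refl (<-≤-trans (+-monoˡ-< r q<p) p+r≤q+r)

ℕ→ℚ-suc : ∀ k → (ℤ.+ suc k) / 1 ≡ 1ℚ + (ℤ.+ k) / 1
ℕ→ℚ-suc k = begin
  (ℤ.+ suc k) / 1                 ≡⟨ cong (λ m → (ℤ.+ 1 ℤ.+ m) / 1) (sym (ℤ.*-identityʳ (ℤ.+ k))) ⟩
  -- ℚ addition only computes on the normal form mkℚ, where it unfolds to (+1 + +k * +1) / 1
  1ℚ + mkℚ (ℤ.+ k) 0 k/1-coprime  ≡⟨ cong (1ℚ +_) (sym (normalize-coprime k/1-coprime)) ⟩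
  1ℚ + (ℤ.+ k) / 1                ∎
  where
  open ≡-Reasoning
  k/1-coprime = Coprimality.sym (Coprimality.1-coprimeTo k)

sumℚ-cong : ∀ {k} {f g : Fin k → ℚ} → f ≗ g → sumℚ f ≡ sumℚ g
sumℚ-cong {zero}  f≗g = refl
sumℚ-cong {suc k} f≗g = cong₂ _+_ (f≗g zero) (sumℚ-cong (f≗g ∘ suc))

sumℚ-mono : ∀ {k} {f g : Fin k → ℚ} → (∀ i → f i ≤ g i) → sumℚ f ≤ sumℚ g
sumℚ-mono {zero}  f≤g = ≤-refl
sumℚ-mono {suc k} f≤g = +-mono-≤ (f≤g zero) (sumℚ-mono (f≤g ∘ suc))

sumℚ-zero : ∀ k → sumℚ {k} (λ _ → 0ℚ) ≡ 0ℚ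
sumℚ-zero zero    = refl
sumℚ-zero (suc k) = trans (+-identityˡ _) (sumℚ-zero k)

sumℚ-nonneg : ∀ {k} {f : Fin k → ℚ} → (∀ i → 0ℚ ≤ f i) → 0ℚ ≤ sumℚ f
sumℚ-nonneg {k} {f} 0≤f = subst (_≤ sumℚ f) (sumℚ-zero k) (sumℚ-mono 0≤f)

sumℚ-distrib-+ : ∀ {k} (f g : Fin k → ℚ) → sumℚ (λ i → f i + g i) ≡ sumℚ f + sumℚ g
sumℚ-distrib-+ {zero}  f g = refl
sumℚ-distrib-+ {suc k} f g =
  trans (cong (f zero + g zero +_) (sumℚ-distrib-+ (f ∘ suc) (g ∘ suc)))
        (interchange (f zero) (g zero) (sumℚ (f ∘ suc)) (sumℚ (g ∘ suc)))

sumℚ-const : ∀ k x → sumℚ {k} (λ _ → x) ≡ x * ((ℤ.+ k) / 1)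
sumℚ-const zero    x = sym (*-zeroʳ x)
sumℚ-const (suc k) x = begin
  x + sumℚ {k} (λ _ → x)      ≡⟨ cong (x +_) (sumℚ-const k x) ⟩
  x + x * ((ℤ.+ k) / 1)       ≡⟨ cong (_+ x * ((ℤ.+ k) / 1)) (sym (*-identityʳ x)) ⟩
  x * 1ℚ + x * ((ℤ.+ k) / 1)  ≡⟨ sym (*-distribˡ-+ x 1ℚ ((ℤ.+ k) / 1)) ⟩
  x * (1ℚ + (ℤ.+ k) / 1)      ≡⟨ cong (x *_) (sym (ℕ→ℚ-suc k)) ⟩
  x * ((ℤ.+ suc k) / 1)       ∎
  where open ≡-Reasoning

sumℚ-select-none : ∀ {k} {f : Fin k → Bool} (g : Fin k → ℚ) → (∀ i → f i ≡ false) →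
  sumℚ (λ i → if f i then g i else 0ℚ) ≡ 0ℚ
sumℚ-select-none {k} g none = trans (sumℚ-cong (select-cong g 0ℚ none)) (sumℚ-zero k)

sumℚ-select-single : ∀ {k} {f : Fin k → Bool} {a} (g : Fin k → ℚ) → TrueExactlyAt f a →
  sumℚ (λ i → if f i then g i else 0ℚ) ≡ g a
sumℚ-select-single {suc k} {f} {zero} g (f0 , off) rewrite f0 =
  trans (cong (g zero +_) (sumℚ-select-none (g ∘ suc) λ i → off (suc i) λ ()))
        (+-identityʳ (g zero))
sumℚ-select-single {suc k} {f} {suc a} g single rewrite proj₂ single zero λ () =
  trans (+-identityˡ _) (sumℚ-select-single (g ∘ suc) (TrueExactlyAt-suc single))

sumℚ-≤-with-vanishing-term : ∀ {k} {f : Fin k → ℚ} {b : ℚ} (j : Fin k) →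
  (∀ i → f i ≤ b) → f j ≡ 0ℚ → sumℚ f + b ≤ sumℚ {k} (λ _ → b)
sumℚ-≤-with-vanishing-term {suc k} {f} {b} zero f≤b fj≡0 = begin
  (f zero + sumℚ (f ∘ suc)) + b ≡⟨ cong (λ x → (x + sumℚ (f ∘ suc)) + b) fj≡0 ⟩
  (0ℚ + sumℚ (f ∘ suc)) + b     ≡⟨ cong (_+ b) (+-identityˡ (sumℚ (f ∘ suc))) ⟩
  sumℚ (f ∘ suc) + b            ≡⟨ +-comm _ b ⟩
  b + sumℚ (f ∘ suc)            ≤⟨ +-monoʳ-≤ b (sumℚ-mono (f≤b ∘ suc)) ⟩
  b + sumℚ {k} (λ _ → b)        ∎
  where open ≤-Reasoning
sumℚ-≤-with-vanishing-term {suc k} {f} {b} (suc j) f≤b fj≡0 = begin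
  (f zero + sumℚ (f ∘ suc)) + b ≡⟨ +-assoc (f zero) _ b ⟩
  f zero + (sumℚ (f ∘ suc) + b) ≤⟨ +-mono-≤ (f≤b zero) (sumℚ-≤-with-vanishing-term j (f≤b ∘ suc) fj≡0) ⟩
  b + sumℚ {k} (λ _ → b)        ∎
  where open ≤-Reasoning

maxℚ-upper : ∀ {k} (f : Fin k → ℚ) i → f i ≤ maxℚ f
maxℚ-upper f zero    = p≤p⊔q (f zero) _
maxℚ-upper f (suc i) = ≤-trans (maxℚ-upper (f ∘ suc) i) (p≤q⊔p (f zero) _)

maxℚ-nonneg : ∀ {k} (f : Fin k → ℚ) → 0ℚ ≤ maxℚ f
maxℚ-nonneg {zero}  f = ≤-refl
maxℚ-nonneg {suc k} f = ≤-trans (maxℚ-nonneg (f ∘ suc)) (p≤q⊔p (f zero) _)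

module _ (D H : Digraph) where

  EmptyRow : VSet D H → V D → Set
  EmptyRow X u = ∀ i → X u i ≡ false

  imageSet-row : ∀ h u → TrueExactlyAt (imageSet D H h u) (h u)
  imageSet-row h u = ⌊≟⌋-TrueExactlyAt (h u)

  imageSet-independent : ∀ {h} → IsHom D H h → Independent D H (imageSet D H h)
  imageSet-independent {h} hom u i v j ui∈I vj∈I adj
    with refl ← TrueExactlyAt-unique (imageSet-row h u) ui∈I
       | refl ← TrueExactlyAt-unique (imageSet-row h v) vj∈I
       | adj
  ... | inj₁ (uv , ¬hu→hv)        = ¬hu→hv (hom u v uv)
  ... | inj₂ (inj₁ (vu , ¬hv→hu)) = ¬hv→hu (hom v u vu)
  ... | inj₂ (inj₂ (refl , i≢i))  = i≢i refl

  independent-row : ∀ {X u a} → Independent D H X → X u a ≡ true → TrueExactlyAt (X u) a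
  independent-row ind Xua = Xua , λ i i≢a →
    Bool.¬-not λ Xui → ind _ _ _ _ Xua Xui (inj₂ (inj₂ (refl , i≢a ∘ sym)))

  row-empty-or-single : ∀ {X} → Independent D H X → ∀ u →
    EmptyRow X u ⊎ ∃ (TrueExactlyAt (X u))
  row-empty-or-single {X} ind u with occupied? (X u)
  ... | yes (a , Xua) = inj₂ (a , independent-row ind Xua)
  ... | no ∄a         = inj₁ (unoccupied ∄a)

  choice-hom : ∀ {X g} → Independent D H X → (∀ u → X u (g u) ≡ true) → IsHom D H g
  choice-hom {g = g} ind Xg u v uv = decidable-stable (arc H (g u) (g v) Bool.≟ true)
    λ ¬gu→gv → ind u (g u) v (g v) (Xg u) (Xg v) (inj₁ (uv , ¬gu→gv))

  empty-row-or-hom : ∀ {X} → Independent D H X →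
    (∃ λ u → EmptyRow X u) ⊎ (∃ λ g → IsHom D H g × ∀ u → TrueExactlyAt (X u) (g u))
  empty-row-or-hom {X} ind with all? (occupied? ∘ X)
  ... | yes occ = inj₂ (proj₁ ∘ occ , choice-hom ind (proj₂ ∘ occ) , independent-row ind ∘ proj₂ ∘ occ)
  ... | no ¬occ = inj₁ (map₂ unoccupied (¬∀⟶∃¬ _ _ (occupied? ∘ X) ¬occ))

  rowCard : VSet D H → V D → ℕ
  rowCard X u = sumℕ (λ i → if X u i then 1 else 0)

  rowCard-≤1 : ∀ {X} → Independent D H X → ∀ u → rowCard X u ℕ.≤ 1
  rowCard-≤1 ind u with row-empty-or-single ind u
  ... | inj₁ empty        = subst (ℕ._≤ 1) (sym (sumℕ-select-none _ empty)) z≤n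
  ... | inj₂ (_ , single) = ℕ.≤-reflexive (sumℕ-select-single _ single)

  card-imageSet : ∀ h → card D H (imageSet D H h) ≡ size D
  card-imageSet h =
    trans (sumℕ-cong λ u → sumℕ-select-single _ (imageSet-row h u)) (sumℕ-ones (size D))

  card-≤ : ∀ {X} → Independent D H X → card D H X ℕ.≤ size D
  card-≤ ind = sumℕ-≤ (rowCard-≤1 ind)

  card-<-of-empty-row : ∀ {X u} → Independent D H X → EmptyRow X u → card D H X ℕ.< size D
  card-<-of-empty-row {u = u} ind empty =
    sumℕ-<-with-vanishing-term u (rowCard-≤1 ind) (sumℕ-select-none _ empty)

  hom⇔independence-number : HOM-nonempty D H ⇔ IndependenceNumber D H (size D)
  hom⇔independence-number = mk⇔ to from
    where
    to : HOM-nonempty D H → IndependenceNumber D H (size D)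
    to (h , hom) = (imageSet D H h , imageSet-independent hom , card-imageSet h) , λ _ → card-≤

    from : IndependenceNumber D H (size D) → HOM-nonempty D H
    from ((X , ind , |X|≡n) , _) with empty-row-or-hom ind
    ... | inj₁ (_ , empty)   = contradiction |X|≡n (ℕ.<⇒≢ (card-<-of-empty-row ind empty))
    ... | inj₂ (g , hom , _) = g , hom

module _ (D H : Digraph) (c : Cost D H) where

  μn : ℚ
  μn = μ D H c * ((ℤ.+ size D) / 1)

  μn² : ℚ
  μn² = sumℚ {size D} (λ _ → μn)

  rowCost : VSet D H → V D → ℚ
  rowCost X u = sumℚ (λ i → if X u i then weight D H c u i else 0ℚ)

  μ-nonneg : 0ℚ ≤ μ D H c
  μ-nonneg = maxℚ-nonneg (λ v → maxℚ (c v))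

  c≤μ : ∀ u i → c u i ≤ μ D H c
  c≤μ u i = ≤-trans (maxℚ-upper (c u) i) (maxℚ-upper (λ v → maxℚ (c v)) u)

  μn-nonneg : 0ℚ ≤ μn
  μn-nonneg = subst (0ℚ ≤_) (sumℚ-const (size D) (μ D H c)) (sumℚ-nonneg {size D} λ _ → μ-nonneg)

  rowCost-≤ : ∀ {X} → Independent D H X → ∀ u → rowCost X u ≤ μ D H c + μn
  rowCost-≤ ind u with row-empty-or-single D H ind u
  ... | inj₁ empty =
    subst (_≤ μ D H c + μn) (sym (sumℚ-select-none _ empty)) (+-mono-≤ μ-nonneg μn-nonneg)
  ... | inj₂ (a , single) =
    subst (_≤ μ D H c + μn) (sym (sumℚ-select-single _ single)) (+-monoˡ-≤ μn (c≤μ u a))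

  setCost-≤-of-empty-row : ∀ {X u} → Independent D H X → EmptyRow D H X u → setCost D H c X ≤ μn²
  setCost-≤-of-empty-row {X} {u} ind empty = +-cancelʳ-≤ (μ D H c + μn) (begin
    setCost D H c X + (μ D H c + μn)
      ≤⟨ sumℚ-≤-with-vanishing-term u (rowCost-≤ ind) (sumℚ-select-none _ empty) ⟩
    sumℚ {size D} (λ _ → μ D H c + μn)   ≡⟨ sumℚ-distrib-+ {size D} (λ _ → μ D H c) (λ _ → μn) ⟩
    sumℚ {size D} (λ _ → μ D H c) + μn²  ≡⟨ cong (_+ μn²) (sumℚ-const (size D) (μ D H c)) ⟩
    μn + μn²                             ≡⟨ +-comm μn μn² ⟩
    μn² + μn                             ≤⟨ +-monoʳ-≤ μn² (p≤q+p μ-nonneg) ⟩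
    μn² + (μ D H c + μn)                 ∎)
    where open ≤-Reasoning

  setCost-of-choice : ∀ {X g} → (∀ u → TrueExactlyAt (X u) (g u)) →
    setCost D H c X ≡ homCost D H c g + μn²
  setCost-of-choice {g = g} single =
    trans (sumℚ-cong λ u → sumℚ-select-single _ (single u)) (sumℚ-distrib-+ (λ u → c u (g u)) _)

  setCost-imageSet : ∀ h → setCost D H c (imageSet D H h) ≡ homCost D H c h + μn²
  setCost-imageSet h = setCost-of-choice (imageSet-row D H h)

  maxCostHom⇔maxCostIndep : (∀ u i → 0ℚ ≤ c u i) → ∀ {h} → IsHom D H h →
    IsMaxCostHom D H c h ⇔ IsMaxCostIndep D H c (imageSet D H h)
  maxCostHom⇔maxCostIndep c≥0 {h} hom = mk⇔ to from
    where
    open ≤-Reasoning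

    to : IsMaxCostHom D H c h → IsMaxCostIndep D H c (imageSet D H h)
    to (_ , h-max) = imageSet-independent D H hom , bound
      where
      bound : ∀ Y → Independent D H Y → setCost D H c Y ≤ setCost D H c (imageSet D H h)
      bound Y indY with empty-row-or-hom D H indY
      ... | inj₁ (_ , empty) = begin
        setCost D H c Y                 ≤⟨ setCost-≤-of-empty-row indY empty ⟩
        μn²                             ≤⟨ p≤q+p (sumℚ-nonneg λ u → c≥0 u (h u)) ⟩
        homCost D H c h + μn²           ≡⟨ setCost-imageSet h ⟨
        setCost D H c (imageSet D H h)  ∎
      ... | inj₂ (g , g-hom , single) = begin
        setCost D H c Y                 ≡⟨ setCost-of-choice single ⟩
        homCost D H c g + μn²           ≤⟨ +-monoˡ-≤ μn² (h-max g g-hom) ⟩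
        homCost D H c h + μn²           ≡⟨ setCost-imageSet h ⟨
        setCost D H c (imageSet D H h)  ∎

    from : IsMaxCostIndep D H c (imageSet D H h) → IsMaxCostHom D H c h
    from (_ , I-max) = hom , λ g g-hom → +-cancelʳ-≤ μn² (begin
      homCost D H c g + μn²           ≡⟨ setCost-imageSet g ⟨
      setCost D H c (imageSet D H g)  ≤⟨ I-max _ (imageSet-independent D H g-hom) ⟩
      setCost D H c (imageSet D H h)  ≡⟨ setCost-imageSet h ⟩
      homCost D H c h + μn²           ∎)

theorem2p1 : (D H : Digraph) (c : Cost D H) → (∀ u i → Positive (c u i)) →
    (HOM-nonempty D H ⇔ IndependenceNumber D H (size D))
    × (HOM-nonempty D H → ∀ h → IsHom D H h →
        (IsMaxCostHom D H c h ⇔ IsMaxCostIndep D H c (imageSet D H h)))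
theorem2p1 D H c c>0 =
  hom⇔independence-number D H , λ _ _ → maxCostHom⇔maxCostIndep D H c c≥0
  where
  c≥0 : ∀ u i → 0ℚ ≤ c u i
  c≥0 u i = <⇒≤ (positive⁻¹ (c u i) {{c>0 u i}})
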